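{- Let $u$ be a uniformly recurrent infinite word over a finite alphabet and let $w$ be a weak bispecial factor of $u$ such that there is exactly one letter $a\in\mathcal E_\ell(w)$ with the property that more than one return word of $w$ starts with a letter in $\mathcal E_r(aw)$. Then $\#\mathcal R(aw)<\#\mathcal R(w)$.
   Context: Let $u=u_0u_1\cdots$ be an infinite word over a finite alphabet $\mathcal A$; factors are finite words occurring in $u$. $u$ is uniformly recurrent if for every $n$ every sufficiently long factor contains all factors of length $n$. For a factor $w$, $\mathcal E_\ell(w)=\{a\in\mathcal A: aw \text{ is a factor}\}$, $\mathcal E_r(w)=\{b\in\mathcal A: wb\text{ is a factor}\}$. If $j<k$ are successive occurrences of $w$ (positions $j$ with $u_j\cdots u_{j+|w|-1}=w$), then $v=u_j\cdots u_{k-1}$ is a return word of $w$ and $vw$ its complete return word; $\mathcal R(w)$ is the set of return words. A return word $v$ of $w$ starts with $b$ if $wb$ is a prefix of $vw$. The bilateral order of $w$ is $B(w)=\#\{awb \text{ factor of } u: a,b\in\mathcal A\}-\#\mathcal E_\ell(w)-\#\mathcal E_r(w)+1$, and $w$ is weak bispecial if $B(w)<0$. -}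

module Defs where

open import Data.Nat using (ℕ; zero; suc; _+_; _∸_; _≤_; _<_)
open import Data.Fin using (Fin)
open import Data.List using (List; []; _∷_; _++_; [_]; length)
open import Data.List.Membership.Propositional using (_∈_)
open import Data.List.Relation.Unary.Unique.Propositional using (Unique)
open import Data.Product using (Σ; ∃; _×_; _,_)
open import Data.Integer as ℤ using (ℤ; +_)
open import Relation.Binary.PropositionalEquality using (_≡_; _≢_)
open import Relation.Nullary using (¬_)

InfWord : ℕ → Set
InfWord k = ℕ → Fin k

slice : ∀ {k} → InfWord k → ℕ → ℕ → List (Fin k)
slice u i zero    = []
slice u i (suc n) = u i ∷ slice u (suc i) n

OccursAt : ∀ {k} → InfWord k → List (Fin k) → ℕ → Set
OccursAt u w i = slice u i (length w) ≡ w

Factor : ∀ {k} → InfWord k → List (Fin k) → Set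
Factor u w = ∃ λ i → OccursAt u w i

UniformlyRecurrent : ∀ {k} → InfWord k → Set
UniformlyRecurrent u =
  ∀ n → ∃ λ N → ∀ i (v : List _) → length v ≡ n → Factor u v →
    ∃ λ j → i ≤ j × j + n ≤ i + N × OccursAt u v j

HasCard : {A : Set} → (A → Set) → ℕ → Set
HasCard {A} P n = Σ (List A) λ L →
  Unique L × (∀ x → x ∈ L → P x) × (∀ x → P x → x ∈ L) × length L ≡ n

Eℓ : ∀ {k} → InfWord k → List (Fin k) → Fin k → Set
Eℓ u w a = Factor u (a ∷ w)

Er : ∀ {k} → InfWord k → List (Fin k) → Fin k → Set
Er u w b = Factor u (w ++ [ b ])

BiExt : ∀ {k} → InfWord k → List (Fin k) → Fin k × Fin k → Set
BiExt u w (a , b) = Factor u (a ∷ (w ++ [ b ]))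

BilateralOrder : ∀ {k} → InfWord k → List (Fin k) → ℤ → Set
BilateralOrder u w B = Σ ℕ λ e → Σ ℕ λ l → Σ ℕ λ r →
  HasCard (BiExt u w) e × HasCard (Eℓ u w) l × HasCard (Er u w) r ×
  B ≡ ((+ e ℤ.- + l) ℤ.- + r) ℤ.+ + 1

WeakBispecial : ∀ {k} → InfWord k → List (Fin k) → Set
WeakBispecial u w = Σ ℤ λ B → BilateralOrder u w B × B ℤ.< + 0

ReturnWord : ∀ {k} → InfWord k → List (Fin k) → List (Fin k) → Set
ReturnWord u w v = Σ ℕ λ j → Σ ℕ λ m →
  j < m × OccursAt u w j × OccursAt u w m ×
  (∀ p → j < p → p < m → ¬ OccursAt u w p) ×
  v ≡ slice u j (m ∸ j)

-- the return word v of w starts with b: w b is a prefix of v w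
StartsWith : ∀ {k} → List (Fin k) → List (Fin k) → Fin k → Set
StartsWith w v b = ∃ λ t → (w ++ [ b ]) ++ t ≡ v ++ w

ManyReturnsInto : ∀ {k} → InfWord k → List (Fin k) → Fin k → Set
ManyReturnsInto u w a = Σ (List _) λ v₁ → Σ (List _) λ v₂ →
  v₁ ≢ v₂ ×
  ReturnWord u w v₁ × ReturnWord u w v₂ ×
  (∃ λ b₁ → Er u (a ∷ w) b₁ × StartsWith w v₁ b₁) ×
  (∃ λ b₂ → Er u (a ∷ w) b₂ × StartsWith w v₂ b₂)

{-# OPTIONS --safe #-}
-- Read a return word X of aw at an occurrence q and send it to the first return word of w
-- inside it, the one at q + 1.  Every later occurrence of w inside the complete return word
-- X aw is preceded by a letter c ≠ a, and by hypothesis all return words of w starting with a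
-- letter of E_r(cw) coincide; so the return words of w tiling X aw are determined one after
-- the other by the first one, and the map is injective.  As w is weak bispecial, some
-- b ∈ E_r(w) has awb not a factor (otherwise counting pairs gives B(w) ≥ 0), and a return
-- word of w starting with b is then missed.  Uniform recurrence makes both sets finite.

module Submission where

open import Defs
open import Data.Nat using (ℕ; _<_)
open import Data.Fin using (Fin)
open import Data.List using (List; _∷_)
open import Data.Product using (Σ; _×_)
open import Relation.Binary.PropositionalEquality using (_≡_)

open import Data.Nat using (zero; suc; _+_; _∸_; _≤_; z≤n; s≤s; _≟_; _<?_; anyUpTo?)
open import Data.Nat.Properties
open import Data.Nat.Induction using (<-rec)
open import Data.Fin.Properties using () renaming (_≟_ to _≟ᶠ_)
import Data.Integer as ℤ
import Data.Integer.Properties as ℤₚ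
open import Data.Integer.Solver using (module +-*-Solver)
open import Data.List using ([]; _++_; [_]; _∷ʳ_; length; map; filter; upTo; deduplicate)
open import Data.List.Properties
  using (≡-dec; length-++; length-map; length-removeAt′; ++-assoc; ++-cancelˡ; ∷-injectiveˡ; ∷-injectiveʳ; ∷ʳ-injective)
open import Data.List.Membership.Propositional using (_∈_; find)
import Data.List.Membership.DecPropositional as DecMembership
open import Data.List.Membership.Propositional.Properties
  using (∈-map⁺; ∈-map⁻; ∈-filter⁺; ∈-filter⁻; ∈-upTo⁺; ∈-++⁻; ∈-deduplicate⁺; ∈-deduplicate⁻)
open import Data.List.Relation.Unary.Any using (here; there; index; _─_)
open import Data.List.Relation.Unary.All as All using (all?)
open import Data.List.Relation.Unary.All.Properties using (¬All⇒Any¬)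
open import Data.List.Relation.Unary.AllPairs using (_∷_)
open import Data.List.Relation.Unary.Unique.Propositional using (Unique)
import Data.List.Relation.Unary.Unique.Propositional.Properties as Unique
import Data.List.Relation.Unary.Unique.DecPropositional.Properties as UniqueDec
open import Data.Maybe using (Maybe; just; nothing)
open import Data.Product using (∃; ∃₂; _,_; proj₁; proj₂)
import Data.Product.Properties as Product
open import Data.Sum using (_⊎_; inj₁; inj₂)
open import Data.Sum.Properties using (inj₁-injective; inj₂-injective)
open import Relation.Nullary using (¬_; Dec; yes; no; contradiction)
open import Relation.Nullary.Decidable using (_×-dec_)
open import Relation.Unary using (Decidable)
open import Relation.Binary.Definitions using (DecidableEquality)
open import Relation.Binary.PropositionalEquality
  using (_≢_; refl; sym; trans; cong; cong₂; subst; subst₂; module ≡-Reasoning)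

∈-─⁺ : ∀ {A : Set} {x y : A} {ys : List A} (x∈ys : x ∈ ys) → y ∈ ys → y ≢ x → y ∈ (ys ─ x∈ys)
∈-─⁺ (here refl) (here refl)   y≢x = contradiction refl y≢x
∈-─⁺ (here refl) (there y∈ys)  _   = y∈ys
∈-─⁺ (there _)   (here refl)   _   = here refl
∈-─⁺ (there x∈ys) (there y∈ys) y≢x = there (∈-─⁺ x∈ys y∈ys y≢x)

module _ {A B : Set} (R : A → B → Set) (R-injective : ∀ {x x′ y} → R x y → R x′ y → x ≡ x′) where

  length-≤-injection : ∀ {xs : List A} {ys : List B} → Unique xs →
                       (∀ {x} → x ∈ xs → ∃ λ y → y ∈ ys × R x y) → length xs ≤ length ys
  length-≤-injection {[]}     _                  _     = z≤n
  length-≤-injection {x ∷ xs} {ys} (x∉xs ∷ unique) image with image (here refl)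
  ... | y , y∈ys , Rxy =
    subst (suc (length xs) ≤_) (sym (length-removeAt′ ys (index y∈ys))) (s≤s (length-≤-injection unique image′))
    where
      image′ : ∀ {x′} → x′ ∈ xs → ∃ λ y′ → y′ ∈ (ys ─ y∈ys) × R x′ y′
      image′ x′∈xs with image (there x′∈xs)
      ... | y′ , y′∈ys , Rx′y′ =
        y′ , ∈-─⁺ y∈ys y′∈ys (λ { refl → All.lookup x∉xs x′∈xs (R-injective Rxy Rx′y′) }) , Rx′y′

  length-<-injection : ∀ {xs : List A} {ys : List B} {y₀} → Unique xs →
                       (∀ {x} → x ∈ xs → ∃ λ y → y ∈ ys × R x y) → y₀ ∈ ys → (∀ {x} → ¬ R x y₀) →
                       length xs < length ys
  length-<-injection {xs} {ys} unique image y₀∈ys y₀-missed =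
    subst (length xs <_) (sym (length-removeAt′ ys (index y₀∈ys))) (s≤s (length-≤-injection unique image′))
    where
      image′ : ∀ {x} → x ∈ xs → ∃ λ y → y ∈ (ys ─ y₀∈ys) × R x y
      image′ x∈xs with image x∈xs
      ... | y , y∈ys , Rxy = y , ∈-─⁺ y₀∈ys y∈ys (λ { refl → y₀-missed Rxy }) , Rxy

hasCard-enumerated : ∀ {A : Set} {P : A → Set} → DecidableEquality A → (xs : List A) →
                     (∀ x → x ∈ xs → P x) → (∀ x → P x → x ∈ xs) → Σ ℕ (HasCard P)
hasCard-enumerated _≟ₐ_ xs sound complete =
  length (deduplicate _≟ₐ_ xs) , deduplicate _≟ₐ_ xs , UniqueDec.deduplicate-! _≟ₐ_ xs ,
  (λ x x∈ → sound x (∈-deduplicate⁻ _≟ₐ_ xs x∈)) , (λ x Px → ∈-deduplicate⁺ _≟ₐ_ (complete x Px)) , refl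

hasCard-<-injection : ∀ {A B : Set} {P : A → Set} {Q : B → Set} {m n} (R : A → B → Set) →
                      HasCard P m → HasCard Q n →
                      (∀ {x} → P x → ∃ λ y → Q y × R x y) → (∀ {x x′ y} → R x y → R x′ y → x ≡ x′) →
                      ∀ {y₀} → Q y₀ → (∀ {x} → ¬ R x y₀) → m < n
hasCard-<-injection R (xs , unique , xs⊆P , _ , refl) (ys , _ , _ , Q⊆ys , refl) image R-injective Qy₀ missed =
  length-<-injection R R-injective unique image′ (Q⊆ys _ Qy₀) missed
  where
    image′ : ∀ {x} → x ∈ xs → ∃ λ y → y ∈ ys × R x y
    image′ x∈xs with image (xs⊆P _ x∈xs)
    ... | y , Qy , Rxy = y , Q⊆ys y Qy , Rxy

least-witness : ∀ {P : ℕ → Set} → Decidable P → ∀ {n} → P n → ∃ λ m → P m × (∀ {d} → d < m → ¬ P d)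
least-witness {P} P? {n} = <-rec (λ n → P n → Least) search n
  where
    Least : Set
    Least = ∃ λ m → P m × (∀ {d} → d < m → ¬ P d)
    search : ∀ n → (∀ {m} → m < n → P m → Least) → P n → Least
    search n smaller Pn with anyUpTo? P? n
    ... | yes (m , m<n , Pm) = smaller m<n Pm
    ... | no none            = n , Pn , λ d<n Pd → none (_ , d<n , Pd)

bilateralOrder-nonneg : ∀ e l r → l + r ≤ suc e → ℤ.+ 0 ℤ.≤ ((ℤ.+ e ℤ.- ℤ.+ l) ℤ.- ℤ.+ r) ℤ.+ ℤ.+ 1
bilateralOrder-nonneg e l r l+r≤1+e = subst (ℤ.+ 0 ℤ.≤_) (sym rearranged) (ℤₚ.i≤j⇒0≤j-i (ℤ.+≤+ l+r≤1+e))
  where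
    open +-*-Solver
    rearranged : ((ℤ.+ e ℤ.- ℤ.+ l) ℤ.- ℤ.+ r) ℤ.+ ℤ.+ 1 ≡ ℤ.+ suc e ℤ.- ℤ.+ (l + r)
    rearranged =
      trans (solve 3 (λ E L R → ((E :- L) :- R) :+ con (ℤ.+ 1) := (con (ℤ.+ 1) :+ E) :- (L :+ R))
                     refl (ℤ.+ e) (ℤ.+ l) (ℤ.+ r))
            (sym (cong₂ ℤ._-_ (ℤₚ.pos-+ 1 e) (ℤₚ.pos-+ l r)))

startsWith-unique : ∀ {k} {x v : List (Fin k)} {b b′} → StartsWith x v b → StartsWith x v b′ → b ≡ b′
startsWith-unique {x = x} {b = b} {b′} (t , eq) (t′ , eq′) =
  ∷-injectiveˡ (++-cancelˡ x _ _ (trans (sym (++-assoc x [ b ] t))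
                                        (trans (trans eq (sym eq′)) (++-assoc x [ b′ ] t′))))

module _ {k : ℕ} (a : Fin k) where

  classify : Maybe (Fin k × Fin k) → Fin k ⊎ Fin k
  classify nothing = inj₂ a
  classify (just (a′ , b)) with a′ ≟ᶠ a
  ... | yes _ = inj₁ b
  ... | no  _ = inj₂ a′

  classify-a : ∀ b → classify (just (a , b)) ≡ inj₁ b
  classify-a b with a ≟ᶠ a
  ... | yes _   = refl
  ... | no  a≢a = contradiction refl a≢a

  classify-≢ : ∀ {a′} b → a′ ≢ a → classify (just (a′ , b)) ≡ inj₂ a′
  classify-≢ {a′} b a′≢a with a′ ≟ᶠ a
  ... | yes a′≡a = contradiction a′≡a a′≢a
  ... | no  _    = refl

module _ {k : ℕ} (u : InfWord k) where

  length-slice : ∀ i n → length (slice u i n) ≡ n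
  length-slice i zero    = refl
  length-slice i (suc n) = cong suc (length-slice (suc i) n)

  slice-++ : ∀ i m n → slice u i (m + n) ≡ slice u i m ++ slice u (i + m) n
  slice-++ i zero    n rewrite +-identityʳ i = refl
  slice-++ i (suc m) n rewrite slice-++ (suc i) m n | +-suc i m = refl

  slice-≡-++ : ∀ {i j} m {n} → slice u i m ≡ slice u j m → slice u (i + m) n ≡ slice u (j + m) n →
               slice u i (m + n) ≡ slice u j (m + n)
  slice-≡-++ {i} {j} m {n} p q = trans (slice-++ i m n) (trans (cong₂ _++_ p q) (sym (slice-++ j m n)))

  slice-length-injective : ∀ {i j m n} → slice u i m ≡ slice u j n → m ≡ n
  slice-length-injective {i} {j} {m} {n} eq =
    trans (sym (length-slice i m)) (trans (cong length eq) (length-slice j n))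

  slice-prefix : ∀ {i j m n} → slice u i n ≡ slice u j n → m ≤ n → slice u i m ≡ slice u j m
  slice-prefix _  z≤n       = refl
  slice-prefix eq (s≤s m≤n) = cong₂ _∷_ (∷-injectiveˡ eq) (slice-prefix (∷-injectiveʳ eq) m≤n)

  slice-window : ∀ {i j n} d {m} → slice u i n ≡ slice u j n → d + m ≤ n → slice u (i + d) m ≡ slice u (j + d) m
  slice-window {i} {j} zero    eq m≤n rewrite +-identityʳ i | +-identityʳ j = slice-prefix eq m≤n
  slice-window {i} {j} (suc d) eq (s≤s d+m≤n) rewrite +-suc i d | +-suc j d =
    slice-window d (∷-injectiveʳ eq) d+m≤n

  letter-window : ∀ {i j n d} → slice u i n ≡ slice u j n → d < n → u (i + d) ≡ u (j + d)
  letter-window {n = n} {d} eq d<n = ∷-injectiveˡ (slice-window d eq (subst (_≤ n) (+-comm 1 d) d<n))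

  occursAt? : ∀ (x : List (Fin k)) i → Dec (OccursAt u x i)
  occursAt? x i = ≡-dec _≟ᶠ_ (slice u i (length x)) x

  occursAt-window : ∀ {x i j n} d → slice u i n ≡ slice u j n → d + length x ≤ n →
                    OccursAt u x (i + d) → OccursAt u x (j + d)
  occursAt-window d eq le occ = trans (sym (slice-window d eq le)) occ

  slice-∷ʳ : ∀ i (x : List (Fin k)) b → slice u i (length (x ∷ʳ b)) ≡ slice u i (length x) ∷ʳ u (i + length x)
  slice-∷ʳ i x b = trans (cong (slice u i) (length-++ x)) (slice-++ i (length x) 1)

  occursAt-∷ʳ⁻ : ∀ {x b i} → OccursAt u (x ∷ʳ b) i → OccursAt u x i × u (i + length x) ≡ b
  occursAt-∷ʳ⁻ {x} {b} {i} occ = ∷ʳ-injective (slice u i (length x)) x (trans (sym (slice-∷ʳ i x b)) occ)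

  occursAt-∷ʳ⁺ : ∀ {x i} → OccursAt u x i → OccursAt u (x ∷ʳ u (i + length x)) i
  occursAt-∷ʳ⁺ {x} {i} occ = trans (slice-∷ʳ i x (u (i + length x))) (cong (_∷ʳ u (i + length x)) occ)

  rightExtension : ∀ {x} → Factor u x → ∃ (Er u x)
  rightExtension (i , occ) = _ , i , occursAt-∷ʳ⁺ occ

  cons-rightExtension : ∀ {c x i} → OccursAt u (c ∷ x) i → Er u (c ∷ x) (u (suc i + length x))
  cons-rightExtension {c} {x} {i} occ =
    i , subst (λ p → OccursAt u ((c ∷ x) ∷ʳ u p) i) (+-suc i (length x)) (occursAt-∷ʳ⁺ occ)

  record NextOccurrence (x : List (Fin k)) (j l : ℕ) : Set where
    constructor nextOccurrence
    field
      positive : 0 < l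
      occurs   : OccursAt u x (j + l)
      minimal  : ∀ {d} → 0 < d → d < l → ¬ OccursAt u x (j + d)

  open NextOccurrence

  ReturnAt : List (Fin k) → ℕ → ℕ → Set
  ReturnAt x j l = OccursAt u x j × NextOccurrence x j l

  nextOccurrence-≤ : ∀ {x j l d} → NextOccurrence x j l → 0 < d → OccursAt u x (j + d) → l ≤ d
  nextOccurrence-≤ next 0<d occ = ≮⇒≥ (λ d<l → minimal next 0<d d<l occ)

  nextOccurrence-unique : ∀ {x j l l′} → NextOccurrence x j l → NextOccurrence x j l′ → l ≡ l′
  nextOccurrence-unique next next′ =
    ≤-antisym (nextOccurrence-≤ next  (positive next′) (occurs next′))
              (nextOccurrence-≤ next′ (positive next)  (occurs next))

  nextOccurrence-within : ∀ {x j e l μ} → NextOccurrence x (j + e) l → e < μ → OccursAt u x (j + μ) →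
                          e + l ≤ μ
  nextOccurrence-within {x} {j} {e} {l} {μ} next e<μ occ = begin
      e + l        ≤⟨ +-monoʳ-≤ e (nextOccurrence-≤ next (m<n⇒0<n∸m e<μ) occ′) ⟩
      e + (μ ∸ e)  ≡⟨ m+[n∸m]≡n (<⇒≤ e<μ) ⟩
      μ            ∎
    where
      open ≤-Reasoning
      occ′ : OccursAt u x (j + e + (μ ∸ e))
      occ′ = subst (OccursAt u x) (sym (trans (+-assoc j e (μ ∸ e)) (cong (j +_) (m+[n∸m]≡n (<⇒≤ e<μ)))))
                   occ

  returnAt-window : ∀ {x i j l} → slice u i (l + length x) ≡ slice u j (l + length x) →
                    ReturnAt x i l → ReturnAt x j l
  returnAt-window {x} {l = l} eq (start , next) =
    trans (sym (slice-prefix eq (m≤n+m (length x) l))) start ,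
    nextOccurrence (positive next) (occursAt-window l eq ≤-refl (occurs next))
      (λ 0<d d<l occ → minimal next 0<d d<l (occursAt-window _ (sym eq) (+-monoˡ-≤ (length x) (<⇒≤ d<l)) occ))

  returnAt⇒returnWord : ∀ {x j l} → ReturnAt x j l → ReturnWord u x (slice u j l)
  returnAt⇒returnWord {x} {j} {l} (start , next) =
    j , j + l , m<m+n j (positive next) , start , occurs next , none-between ,
    cong (slice u j) (sym (m+n∸m≡n j l))
    where
      none-between : ∀ p → j < p → p < j + l → ¬ OccursAt u x p
      none-between p j<p p<j+l occ =
        minimal next (m<n⇒0<n∸m j<p) (+-cancelˡ-< j _ _ (subst (_< j + l) (sym j+d≡p) p<j+l))
                (subst (OccursAt u x) (sym j+d≡p) occ)
        where
          j+d≡p : j + (p ∸ j) ≡ p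
          j+d≡p = m+[n∸m]≡n (<⇒≤ j<p)

  returnWord⇒returnAt : ∀ {x v} → ReturnWord u x v → ∃₂ λ j l → ReturnAt x j l × v ≡ slice u j l
  returnWord⇒returnAt {x} (j , m , j<m , start , end , none-between , refl) =
    j , m ∸ j ,
    (start , nextOccurrence (m<n⇒0<n∸m j<m) (subst (OccursAt u x) (sym j+l≡m) end) minimal′) , refl
    where
      j+l≡m : j + (m ∸ j) ≡ m
      j+l≡m = m+[n∸m]≡n (<⇒≤ j<m)
      minimal′ : ∀ {d} → 0 < d → d < m ∸ j → ¬ OccursAt u x (j + d)
      minimal′ 0<d d<l = none-between _ (m<m+n j 0<d) (subst (_ <_) j+l≡m (+-monoʳ-< j d<l))

  returnAt-startsWith : ∀ {x j l} → ReturnAt x j l → StartsWith x (slice u j l) (u (j + length x))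
  returnAt-startsWith {l = zero}  (_ , nextOccurrence () _ _)
  returnAt-startsWith {x} {j} {suc l} (start , next) = slice u (suc (j + length x)) l , (begin
      (x ∷ʳ u (j + length x)) ++ slice u (suc (j + length x)) l  ≡⟨ ++-assoc x _ _ ⟩
      x ++ slice u (j + length x) (suc l)                        ≡⟨ cong (_++ slice u (j + length x) (suc l)) (sym start) ⟩
      slice u j (length x) ++ slice u (j + length x) (suc l)     ≡⟨ sym (slice-++ j (length x) (suc l)) ⟩
      slice u j (length x + suc l)                               ≡⟨ cong (slice u j) (+-comm (length x) (suc l)) ⟩
      slice u j (suc l + length x)                               ≡⟨ slice-++ j (suc l) (length x) ⟩
      slice u j (suc l) ++ slice u (j + suc l) (length x)        ≡⟨ cong (slice u j (suc l) ++_) (occurs next) ⟩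
      slice u j (suc l) ++ x                                     ∎)
    where open ≡-Reasoning

  module _ (ur : UniformlyRecurrent u) where

    gapBound : List (Fin k) → ℕ
    gapBound x = suc (proj₁ (ur (length x)))

    later-occurrence : ∀ {x} → Factor u x → ∀ j → ∃ λ d → 0 < d × d ≤ gapBound x × OccursAt u x (j + d)
    later-occurrence {x} fx j with proj₂ (ur (length x)) (suc j) x refl fx
    ... | p , j<p , p+|x|≤ , occ =
      p ∸ j , m<n⇒0<n∸m j<p ,
      m≤n+o⇒m∸n≤o p j (≤-trans (m≤m+n p (length x)) (subst (p + length x ≤_) (sym (+-suc j _)) p+|x|≤)) ,
      subst (OccursAt u x) (sym (m+[n∸m]≡n (<⇒≤ j<p))) occ

    next-occurrence : ∀ {x} → Factor u x → ∀ j → ∃ (NextOccurrence x j)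
    next-occurrence {x} fx j with later-occurrence fx j
    ... | _ , 0<d , _ , occ with least-witness (λ d → (0 <? d) ×-dec occursAt? x (j + d)) (0<d , occ)
    ...   | l , (0<l , occₗ) , below = l , nextOccurrence 0<l occₗ (λ 0<d d<l occ → below d<l (0<d , occ))

    nextOccurrence-≤-gapBound : ∀ {x j l} → Factor u x → NextOccurrence x j l → l ≤ gapBound x
    nextOccurrence-≤-gapBound {j = j} fx next with later-occurrence fx j
    ... | _ , 0<d , d≤gap , occ = ≤-trans (nextOccurrence-≤ next 0<d occ) d≤gap

    window-recurs-early : ∀ n j → ∃ λ j′ → j′ + n ≤ proj₁ (ur n) × slice u j′ n ≡ slice u j n
    window-recurs-early n j
      with proj₂ (ur n) 0 (slice u j n) (length-slice j n) (j , cong (slice u j) (length-slice j n))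
    ... | j′ , _ , j′+n≤ , occ = j′ , j′+n≤ , trans (cong (slice u j′) (sym (length-slice j n))) occ

    -- A complete return word of x fits in a window of length K, and every window of length K
    -- already occurs before position proj₁ (ur K).
    returnWords-finite : ∀ {x} → Factor u x → Σ ℕ (HasCard (ReturnWord u x))
    returnWords-finite {x} fx = hasCard-enumerated (≡-dec _≟ᶠ_) candidates sound complete
      where
        K : ℕ
        K = gapBound x + length x
        returnWordAt : ℕ → List (Fin k)
        returnWordAt j = slice u j (proj₁ (next-occurrence fx j))
        positions : List ℕ
        positions = filter (occursAt? x) (upTo (proj₁ (ur K)))
        candidates : List (List (Fin k))
        candidates = map returnWordAt positions

        sound : ∀ v → v ∈ candidates → ReturnWord u x v
        sound v v∈ with ∈-map⁻ returnWordAt {xs = positions} v∈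
        ... | j , j∈ , refl =
          returnAt⇒returnWord (proj₂ (∈-filter⁻ (occursAt? x) {xs = upTo (proj₁ (ur K))} j∈) ,
                               proj₂ (next-occurrence fx j))

        complete : ∀ v → ReturnWord u x v → v ∈ candidates
        complete v rw with returnWord⇒returnAt rw
        ... | j , l , ret@(_ , next) , refl with window-recurs-early K j
        ...   | j′ , j′+K≤ , window =
          subst (_∈ candidates) (sym same-word)
                (∈-map⁺ returnWordAt (∈-filter⁺ (occursAt? x) (∈-upTo⁺ j′<) (proj₁ ret′)))
          where
            l+|x|≤K : l + length x ≤ K
            l+|x|≤K = +-monoˡ-≤ (length x) (nextOccurrence-≤-gapBound fx next)
            ret′ : ReturnAt x j′ l
            ret′ = returnAt-window (sym (slice-prefix window l+|x|≤K)) ret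
            same-word : slice u j l ≡ returnWordAt j′
            same-word = trans (sym (slice-prefix window (≤-trans (m≤m+n l (length x)) l+|x|≤K)))
                              (cong (slice u j′) (nextOccurrence-unique (proj₂ ret′) (proj₂ (next-occurrence fx j′))))
            j′< : j′ < proj₁ (ur K)
            j′< = <-≤-trans (m<m+n j′ (s≤s z≤n)) j′+K≤

  module _ {w : List (Fin k)} (a : Fin k) where

    open DecMembership (Product.≡-dec (_≟ᶠ_ {k}) (_≟ᶠ_ {k})) using (_∈?_)

    -- b ↦ just (a , b), a ↦ nothing and a′ ≢ a ↦ just (a′ , b′) for some factor a′wb′ inject
    -- E_r(w) ⊎ E_ℓ(w) into one point plus the bilateral extensions; classify a inverts this.
    extensions-count : ∀ {e l r} → HasCard (BiExt u w) e → HasCard (Eℓ u w) l → HasCard (Er u w) r →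
                       (∀ b → Er u w b → BiExt u w (a , b)) → l + r ≤ suc e
    extensions-count (Le , _ , _ , Bi⊆Le , refl) (Ll , uniqueL , Ll⊆Eℓ , _ , refl)
                     (Lr , uniqueR , Lr⊆Er , _ , refl) all-extend =
      subst₂ _≤_ length-xs (cong suc (length-map just Le))
        (length-≤-injection (λ z p → classify a p ≡ z) (λ p q → trans (sym p) q) unique-xs image)
      where
        xs : List (Fin k ⊎ Fin k)
        xs = map inj₂ Ll ++ map inj₁ Lr
        length-xs : length xs ≡ length Ll + length Lr
        length-xs = trans (length-++ (map inj₂ Ll)) (cong₂ _+_ (length-map inj₂ Ll) (length-map inj₁ Lr))
        disjoint : ∀ {z} → ¬ (z ∈ map inj₂ Ll × z ∈ map inj₁ Lr)
        disjoint (z∈₂ , z∈₁) with ∈-map⁻ inj₂ z∈₂ | ∈-map⁻ inj₁ z∈₁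
        ... | _ , _ , refl | _ , _ , ()
        unique-xs : Unique xs
        unique-xs = Unique.++⁺ (Unique.map⁺ inj₂-injective uniqueL) (Unique.map⁺ inj₁-injective uniqueR) disjoint
        image : ∀ {z} → z ∈ xs → ∃ λ p → p ∈ nothing ∷ map just Le × classify a p ≡ z
        image z∈ with ∈-++⁻ (map inj₂ Ll) z∈
        image z∈ | inj₁ z∈₂ with ∈-map⁻ inj₂ z∈₂
        ... | a′ , a′∈ , refl with a′ ≟ᶠ a
        ...   | yes refl = nothing , here refl , refl
        ...   | no a′≢a with rightExtension (Ll⊆Eℓ a′ a′∈)
        ...     | b , bi = just (a′ , b) , there (∈-map⁺ just (Bi⊆Le _ bi)) , classify-≢ a b a′≢a
        image z∈ | inj₂ z∈₁ with ∈-map⁻ inj₁ z∈₁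
        ... | b , b∈ , refl =
          just (a , b) , there (∈-map⁺ just (Bi⊆Le _ (all-extend b (Lr⊆Er b b∈)))) , classify-a a b

    missing-right-extension : WeakBispecial u w → ∃ λ b → Er u w b × ¬ BiExt u w (a , b)
    missing-right-extension (_ , (e , l , r , cardBi@(Le , _ , Le⊆Bi , Bi⊆Le , _) , cardL ,
                                  cardR@(Lr , _ , Lr⊆Er , Er⊆Lr , _) , B≡) , B<0)
      with all? (λ (b : Fin k) → (a , b) ∈? Le) Lr
    ... | yes all-in =
      contradiction B<0 (ℤₚ.≤⇒≯ (subst (ℤ.+ 0 ℤ.≤_) (sym B≡) (bilateralOrder-nonneg e l r count)))
      where
        count : l + r ≤ suc e
        count = extensions-count cardBi cardL cardR (λ b erb → Le⊆Bi _ (All.lookup all-in (Er⊆Lr b erb)))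
    ... | no not-all with find (¬All⇒Any¬ (λ (b : Fin k) → (a , b) ∈? Le) Lr not-all)
    ...   | b , b∈ , ab∉ = b , Lr⊆Er b b∈ , λ bi → ab∉ (Bi⊆Le _ bi)

  module FirstReturns (ur : UniformlyRecurrent u) {w : List (Fin k)} (fw : Factor u w) {a : Fin k}
                      (unique-a : ∀ a′ → Eℓ u w a′ → ManyReturnsInto u w a′ → a′ ≡ a) where

    returns-after-coincide : ∀ {c p p₂ L L₂} → c ≢ a → OccursAt u (c ∷ w) p → OccursAt u (c ∷ w) p₂ →
                             NextOccurrence w (suc p) L → NextOccurrence w (suc p₂) L₂ →
                             slice u (suc p) L ≡ slice u (suc p₂) L₂
    returns-after-coincide {c} {p} {p₂} {L} {L₂} c≢a occ occ₂ next next₂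
      with ≡-dec _≟ᶠ_ (slice u (suc p) L) (slice u (suc p₂) L₂)
    ... | yes same      = same
    ... | no  different = contradiction (unique-a c (p , occ) two-returns) c≢a
      where
        ret : ReturnAt w (suc p) L
        ret = ∷-injectiveʳ occ , next
        ret₂ : ReturnAt w (suc p₂) L₂
        ret₂ = ∷-injectiveʳ occ₂ , next₂
        two-returns : ManyReturnsInto u w c
        two-returns = _ , _ , different , returnAt⇒returnWord ret , returnAt⇒returnWord ret₂ ,
                      (_ , cons-rightExtension occ , returnAt-startsWith ret) ,
                      (_ , cons-rightExtension occ₂ , returnAt-startsWith ret₂)

    closing-w : ∀ {q μ} → ReturnAt (a ∷ w) q μ → OccursAt u w (suc q + μ)
    closing-w (_ , next) = ∷-injectiveʳ (occurs next)

    first-return-≤ : ∀ {q μ l} → ReturnAt (a ∷ w) q μ → NextOccurrence w (suc q) l → l ≤ μ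
    first-return-≤ ret next = nextOccurrence-≤ next (positive (proj₂ ret)) (closing-w ret)

    prepend-a : ∀ {q q₂ μ μ₂ e} → ReturnAt (a ∷ w) q μ → ReturnAt (a ∷ w) q₂ μ₂ →
                slice u (suc q) e ≡ slice u (suc q₂) e → slice u q (suc e) ≡ slice u q₂ (suc e)
    prepend-a (aw , _) (aw₂ , _) = cong₂ _∷_ (trans (∷-injectiveˡ aw) (sym (∷-injectiveˡ aw₂)))

    agreeing-returns-coincide : ∀ {q q₂ μ μ₂} → ReturnAt (a ∷ w) q μ → ReturnAt (a ∷ w) q₂ μ₂ → μ ≤ μ₂ →
                                slice u (suc q) μ ≡ slice u (suc q₂) μ → OccursAt u w (suc q₂ + μ) →
                                μ ≡ μ₂ × slice u q μ ≡ slice u q₂ μ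
    agreeing-returns-coincide {q} {q₂} {μ} ret@(_ , next) ret₂@(_ , next₂) μ≤μ₂ same occ₂ =
      ≤-antisym μ≤μ₂ (nextOccurrence-≤ next₂ (positive next) aw-at-μ) , slice-prefix window (n≤1+n μ)
      where
        window : slice u q (suc μ) ≡ slice u q₂ (suc μ)
        window = prepend-a ret ret₂ same
        aw-at-μ : OccursAt u (a ∷ w) (q₂ + μ)
        aw-at-μ = cong₂ _∷_ (trans (sym (letter-window window (n<1+n μ))) (∷-injectiveˡ (occurs next))) occ₂

    module Lockstep {q q₂ μ μ₂} (ret : ReturnAt (a ∷ w) q μ) (ret₂ : ReturnAt (a ∷ w) q₂ μ₂) where

      Synchronised : ℕ → Set
      Synchronised e =
        slice u (suc q) e ≡ slice u (suc q₂) e × OccursAt u w (suc q + e) × OccursAt u w (suc q₂ + e)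

      next-returns-coincide : ∀ {e L L₂} → 0 < e → e < μ → Synchronised e →
                              NextOccurrence w (suc q + e) L → NextOccurrence w (suc q₂ + e) L₂ →
                              slice u (suc q + e) L ≡ slice u (suc q₂ + e) L₂
      next-returns-coincide {e} 0<e e<μ (same , occ , occ₂) =
        returns-after-coincide c≢a (cong (u (q + e) ∷_) occ) (cong₂ _∷_ (sym c≡c₂) occ₂)
        where
          c≡c₂ : u (q + e) ≡ u (q₂ + e)
          c≡c₂ = letter-window (prepend-a ret ret₂ same) (n<1+n e)
          c≢a : u (q + e) ≢ a
          c≢a c≡a = minimal (proj₂ ret) 0<e e<μ (cong₂ _∷_ c≡a occ)

      step : ∀ {e} → 0 < e → e < μ → e < μ₂ → Synchronised e →
             ∃ λ L → 0 < L × e + L ≤ μ × e + L ≤ μ₂ × Synchronised (e + L)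
      step {e} 0<e e<μ e<μ₂ sync@(same , _ , _)
        with next-occurrence ur fw (suc q + e) | next-occurrence ur fw (suc q₂ + e)
      ... | L , next | L₂ , next₂ with next-returns-coincide 0<e e<μ sync next next₂
      ...   | returns with slice-length-injective returns
      ...     | refl =
        L , positive next ,
        nextOccurrence-within next e<μ (closing-w ret) , nextOccurrence-within next₂ e<μ₂ (closing-w ret₂) ,
        slice-≡-++ e same returns ,
        subst (OccursAt u w) (+-assoc (suc q) e L) (occurs next) ,
        subst (OccursAt u w) (+-assoc (suc q₂) e L) (occurs next₂)

      walk : ∀ fuel {e} → μ ≤ e + fuel → 0 < e → e ≤ μ → e ≤ μ₂ → Synchronised e →
             Synchronised μ × μ ≤ μ₂ ⊎ Synchronised μ₂ × μ₂ ≤ μ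
      walk fuel {e} _ _ e≤μ e≤μ₂ sync with e ≟ μ | e ≟ μ₂
      ... | yes refl | _        = inj₁ (sync , e≤μ₂)
      ... | no  _    | yes refl = inj₂ (sync , e≤μ)
      walk zero {e} μ≤e _ e≤μ _ _ | no e≢μ | no _ =
        contradiction (≤-antisym e≤μ (subst (μ ≤_) (+-identityʳ e) μ≤e)) e≢μ
      walk (suc fuel) {e} μ≤e+1+fuel 0<e e≤μ e≤μ₂ sync | no e≢μ | no e≢μ₂
        with step 0<e (≤∧≢⇒< e≤μ e≢μ) (≤∧≢⇒< e≤μ₂ e≢μ₂) sync
      ... | L , 0<L , e+L≤μ , e+L≤μ₂ , sync′ =
        walk fuel μ≤e+L+fuel (<-≤-trans 0<e (m≤m+n e L)) e+L≤μ e+L≤μ₂ sync′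
        where
          μ≤e+L+fuel : μ ≤ e + L + fuel
          μ≤e+L+fuel = ≤-trans μ≤e+1+fuel
            (subst (_≤ e + L + fuel) (sym (+-suc e fuel)) (+-monoˡ-≤ fuel (m<m+n e 0<L)))

      first-return-determines : ∀ {l} → NextOccurrence w (suc q) l → NextOccurrence w (suc q₂) l →
                                slice u (suc q) l ≡ slice u (suc q₂) l → μ ≡ μ₂ × slice u q μ ≡ slice u q₂ μ
      first-return-determines next next₂ same
        with walk μ (m≤n+m μ _) (positive next) (first-return-≤ ret next) (first-return-≤ ret₂ next₂)
                  (same , occurs next , occurs next₂)
      ... | inj₁ ((same′ , _ , occ₂) , μ≤μ₂) = agreeing-returns-coincide ret ret₂ μ≤μ₂ same′ occ₂
      ... | inj₂ ((same′ , occ , _) , μ₂≤μ) with agreeing-returns-coincide ret₂ ret μ₂≤μ (sym same′) occ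
      ...   | refl , eq = refl , sym eq

    record FirstReturnOf (X y : List (Fin k)) : Set where
      constructor firstReturn
      field
        q μ l      : ℕ
        aw-return  : ReturnAt (a ∷ w) q μ
        X≡         : X ≡ slice u q μ
        w-return   : NextOccurrence w (suc q) l
        y≡         : y ≡ slice u (suc q) l

    firstReturn-exists : ∀ {X} → ReturnWord u (a ∷ w) X → ∃ λ y → ReturnWord u w y × FirstReturnOf X y
    firstReturn-exists rw with returnWord⇒returnAt rw
    ... | q , μ , ret , X≡ with next-occurrence ur fw (suc q)
    ...   | l , next = slice u (suc q) l , returnAt⇒returnWord (∷-injectiveʳ (proj₁ ret) , next) ,
                       firstReturn q μ l ret X≡ next refl

    firstReturn-injective : ∀ {X X′ y} → FirstReturnOf X y → FirstReturnOf X′ y → X ≡ X′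
    firstReturn-injective (firstReturn q μ l ret refl next refl) (firstReturn q₂ μ₂ l₂ ret₂ refl next₂ y≡)
      with slice-length-injective y≡
    ... | refl with Lockstep.first-return-determines ret ret₂ next next₂ y≡
    ...   | refl , same = same

    missed-return : ∀ {b} → Er u w b → ¬ BiExt u w (a , b) →
                    ∃ λ ρ → ReturnWord u w ρ × ∀ {X} → ¬ FirstReturnOf X ρ
    missed-return {b} (s , occ) ¬awb with occursAt-∷ʳ⁻ occ
    ... | w-at-s , followed-by-b with next-occurrence ur fw s
    ...   | L , next = slice u s L , returnAt⇒returnWord (w-at-s , next) , not-first
      where
        not-first : ∀ {X} → ¬ FirstReturnOf X (slice u s L)
        not-first (firstReturn q _ l (aw , _) _ next′ ρ≡) =
          ¬awb (subst (λ c → BiExt u w (a , c)) (trans (sym same-letter) followed-by-b)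
                      (cons-rightExtension aw))
          where
            same-letter : u (s + length w) ≡ u (suc q + length w)
            same-letter =
              startsWith-unique (subst (λ v → StartsWith w v (u (s + length w))) ρ≡ (returnAt-startsWith (w-at-s , next)))
                                (returnAt-startsWith (∷-injectiveʳ aw , next′))

lemma5p5 : (k : ℕ) (u : InfWord k) → UniformlyRecurrent u →
           (w : List (Fin k)) → Factor u w → WeakBispecial u w →
           (a : Fin k) → Eℓ u w a → ManyReturnsInto u w a →
           (∀ a′ → Eℓ u w a′ → ManyReturnsInto u w a′ → a′ ≡ a) →
           Σ ℕ λ m → Σ ℕ λ n →
             HasCard (ReturnWord u (a ∷ w)) n × HasCard (ReturnWord u w) m × n < m
lemma5p5 k u ur w fw bispecial a ea _ unique-a =
  let open FirstReturns u ur fw unique-a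
      (n , card-aw)             = returnWords-finite u ur ea
      (m , card-w)              = returnWords-finite u ur fw
      (_ , wb-factor , ¬awb)    = missing-right-extension u a bispecial
      (ρ , ρ-return , ρ-missed) = missed-return wb-factor ¬awb
  in m , n , card-aw , card-w ,
     hasCard-<-injection FirstReturnOf card-aw card-w firstReturn-exists firstReturn-injective ρ-return ρ-missed
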